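{- Let $\mathcal P=(\nu_1,\dots,\nu_N)$ be a Newton polygon, with $h,\ B_i,\ \mu,\ x_{\mathcal P}$ as in the context, and let $X_*(T)^{\mathcal P}=\{\lambda\in\mathbb Z^h:\epsilon^{ -\lambda}x_{\mathcal P}\epsilon^\lambda\in W\epsilon^\mu W\}$. The group $\Lambda=\{\lambda\in\mathbb Z^h:\lambda \text{ is constant on each } B_i\}$ acts on $X_*(T)^{\mathcal P}$ by addition, and this action has finitely many orbits.
   Context: $k$ is an algebraically closed field of characteristic $p>0$; $\mathcal O$ is $W(k)$ or $k[[t]]$, with uniformizer $\epsilon=p$ resp. $t$, and $\sigma$ the Frobenius lift on $W(k)$ resp. the automorphism of $k[[t]]$ fixing $t$ and acting by $a\mapsto a^p$ on $k$. For coprime integers $n,m\ge0$, $H_{n,m}$ is the free $\mathcal O$-module with basis $e_1,\dots,e_{n+m}$; for $i>n+m$ write $i=a(n+m)+b$, $1\le b\le n+m$, and set $e_i:=\epsilon^ae_b$; $F(e_i)=e_{i+n}$ extended $\sigma$-linearly. $x_{n,m}$ is the matrix of $F$ w.r.t. the ordered basis $(e_{n+m},\dots,e_1)$ (the matrix $A$ of a $\sigma$-linear $F$ w.r.t. $(b_j)$ satisfies $F(b_j)=\sum_iA_{ij}b_i$). For $\nu\in\mathbb Q\cap[0,1]$, $n_\nu,m_\nu\ge0$ are coprime with $\nu=n_\nu/(n_\nu+m_\nu)$. A Newton polygon is a sequence $\mathcal P=(\nu_1\le\dots\le\nu_N)$; $(n_i,m_i)=(n_{\nu_i},m_{\nu_i})$,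 $h_i=n_i+m_i$, $h=\sum h_i$, $s=\sum n_i$, $B_i=\{h_1+\dots+h_{i-1}+1,\dots,h_1+\dots+h_i\}$. $x_{\mathcal P}$ is the block-diagonal $h\times h$ matrix with $i$-th diagonal block (indices $B_i$) equal to $x_{n_i,m_i}$. $W=S_h$ as permutation matrices; $\epsilon^\lambda=\mathrm{diag}(\epsilon^{\lambda_1},\dots,\epsilon^{\lambda_h})$; $\mu=(1,\dots,1,0,\dots,0)\in\mathbb Z^h$ with $s$ ones; $W\epsilon^\mu W=\{w_1\epsilon^\mu w_2:w_i\in W\}$. -}

module Defs where

open import Level using (Level; _⊔_)
open import Algebra.Bundles using (CommutativeRing)
import Algebra.Definitions.RawMonoid as RawMonoidDefs
open import Data.Nat as ℕ using (ℕ; zero; suc; _∸_; _≡ᵇ_; _<ᵇ_)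
open import Data.Nat.DivMod using (_/_; _%_)
open import Data.Integer as ℤ using (ℤ; +_; -[1+_])
open import Data.Rational as ℚ using (ℚ)
open import Data.Fin using (Fin; toℕ; splitAt; _↑ʳ_; _↑ˡ_)
open import Data.Fin.Permutation using (Permutation; _⟨$⟩ʳ_)
open import Data.Bool using (Bool; if_then_else_)
open import Data.List using (List; []; _∷_)
open import Data.Sum using (inj₁; inj₂)
open import Data.Product using (_×_; ∃₂)
open import Data.Unit.Polymorphic using (⊤)
open import Relation.Binary.PropositionalEquality using (_≡_)

-- For ν ∈ ℚ ∩ [0,1] written in lowest terms ν = p/q (q ≥ 1), the coprime
-- pair (n_ν, m_ν) with ν = n_ν/(n_ν+m_ν) is n_ν = p, m_ν = q - p.
nν : ℚ → ℕ
nν ν = ℤ.∣ ℚ.numerator ν ∣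

mν : ℚ → ℕ
mν ν = ℚ.denominatorℕ ν ∸ nν ν

hν : ℚ → ℕ
hν ν = nν ν ℕ.+ mν ν

hP : List ℚ → ℕ
hP []      = 0
hP (ν ∷ P) = hν ν ℕ.+ hP P

sP : List ℚ → ℕ
sP []      = 0
sP (ν ∷ P) = nν ν ℕ.+ sP P

Cochar : ℕ → Set
Cochar h = Fin h → ℤ

_+ᶜ_ : ∀ {h} → Cochar h → Cochar h → Cochar h
(λ₁ +ᶜ λ₂) i = λ₁ i ℤ.+ λ₂ i

-- λ is constant on each block B_i (Fin (hP P) = Fin h₁ ⊎ Fin h₂ ⊎ …)
ConstOnBlocks : (P : List ℚ) → Cochar (hP P) → Set
ConstOnBlocks []      l = ⊤
ConstOnBlocks (ν ∷ P) l =
  (∀ (a b : Fin (hν ν)) → l (a ↑ˡ hP P) ≡ l (b ↑ˡ hP P))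
  × ConstOnBlocks P (λ i → l (hν ν ↑ʳ i))

-- Matrices over the fraction field K of 𝒪, abstracted as a commutative
-- ring K with a distinguished invertible element ε (the uniformizer).

module Over {c ℓ : Level} (K : CommutativeRing c ℓ) (ε ε⁻¹ : CommutativeRing.Carrier K) where
  open CommutativeRing K
  open RawMonoidDefs +-rawMonoid using (sum)

  Mat : ℕ → Set c
  Mat h = Fin h → Fin h → Carrier

  _·_ : ∀ {h} → Mat h → Mat h → Mat h
  (A · B) i j = sum (λ k → A i k * B k j)

  _≈ᴹ_ : ∀ {h} → Mat h → Mat h → Set ℓ
  A ≈ᴹ B = ∀ i j → A i j ≈ B i j

  εⁿ : ℕ → Carrier
  εⁿ zero    = 1#
  εⁿ (suc k) = ε * εⁿ k

  ε⁻ⁿ : ℕ → Carrier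
  ε⁻ⁿ zero    = 1#
  ε⁻ⁿ (suc k) = ε⁻¹ * ε⁻ⁿ k

  εᶻ : ℤ → Carrier
  εᶻ (+ k)     = εⁿ k
  εᶻ -[1+ k ]  = ε⁻ⁿ (suc k)

  diag : ∀ {h} → (Fin h → Carrier) → Mat h
  diag d i j = if toℕ i ≡ᵇ toℕ j then d i else 0#

  ε^ : ∀ {h} → Cochar h → Mat h
  ε^ l = diag (λ i → εᶻ (l i))

  ε^- : ∀ {h} → Cochar h → Mat h
  ε^- l = diag (λ i → εᶻ (ℤ.- l i))

  permMat : ∀ {h} → Permutation h h → Mat h
  permMat π i j = if toℕ (π ⟨$⟩ʳ j) ≡ᵇ toℕ i then 1# else 0#

  -- μ = (1,…,1,0,…,0) with s ones, as the matrix ε^μ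
  εμ : (h s : ℕ) → Mat h
  εμ h s = diag (λ i → if toℕ i <ᵇ s then ε else 1#)

  InWεμW : ∀ {h} → ℕ → Mat h → Set ℓ
  InWεμW {h} s M = ∃₂ λ (w₁ w₂ : Permutation h h) →
    M ≈ᴹ ((permMat w₁ · εμ h s) · permMat w₂)

  -- Matrix of F on the rank-h module with F(e_i) = e_{i+n}, where
  -- e_i = ε^a e_b for i = a h + b, 1 ≤ b ≤ h, w.r.t. the ordered basis
  -- (e_h, …, e_1): position j (0-based) is e_{h-j}.
  -- F(e_{h-j}) = e_t with t = h - j + n, and t - 1 = a h + (b - 1).
  xmat : (n h : ℕ) → Mat h
  xmat n (suc k) i j =
    let h = suc k
        t = h ∸ toℕ j ℕ.+ n
        a = (t ∸ 1) / h
        b = suc ((t ∸ 1) % h)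
    in if toℕ i ≡ᵇ (h ∸ b) then εⁿ a else 0#

  x : (n m : ℕ) → Mat (n ℕ.+ m)
  x n m = xmat n (n ℕ.+ m)

  xP : (P : List ℚ) → Mat (hP P)
  xP []      ()
  xP (ν ∷ P) i j with splitAt (hν ν) i | splitAt (hν ν) j
  ... | inj₁ a | inj₁ b = x (nν ν) (mν ν) a b
  ... | inj₂ a | inj₂ b = xP P a b
  ... | inj₁ _ | inj₂ _ = 0#
  ... | inj₂ _ | inj₁ _ = 0#

  XP : (P : List ℚ) → Cochar (hP P) → Set ℓ
  XP P l = InWεμW (sP P) ((ε^- l · xP P) · ε^ l)

module Submission where

-- All matrices involved are monomial (one nonzero entry per column).  In
-- 0-based positions the block x_{n,m}, h = n + m, sends column j to row
-- j + m (mod h), with entry ε on the first n columns and 1 elsewhere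
-- (module Cycle).  Hence ε^{−λ} x_𝒫 ε^λ is monomial with entry ε^{e_j} in
-- column j, where e_j = a_j + λ_j − λ_{σ(j)} with σ = rowOf the row map
-- and a = rowExp the exponents of x_𝒫 (Polygon.exponent), while each
-- w₁ ε^μ w₂ is monomial with s entries ε and h − s entries 1.  Comparing
-- entries gives λ ∈ X_*(T)^𝒫 ⇔ all e_j ∈ {0, 1} (module Conjugation); for
-- "⇐" the permutations are obtained by sorting, using Σ e_j = s.
-- Block-constant shifts leave every e_j unchanged, which gives the action.
-- For finiteness, 0 ≤ ν ≤ 1 makes h_i and m_i coprime (module Slopes), so σ
-- is a single cycle on each block; since e_j ∈ {0, 1} forces
-- |λ_{σ(j)} − λ_j| ≤ 1, subtracting from λ its first value on each block
-- leaves an admissible cocharacter with entries in [−h, h], and these form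
-- a finite list of representatives (module Finiteness).

module Cycle where

  open import Data.Nat using (ℕ; zero; suc; _+_; _*_; _∸_; _≤_; _<_; s≤s; s≤s⁻¹; NonZero; >-nonZero)
  open import Data.Nat.Properties
  open import Data.Nat.DivMod
  open import Data.Nat.Divisibility using (_∣_; divides; ∣⇒≤)
  open import Data.Nat.Coprimality using (Coprime; coprime-divisor)
  open import Data.Nat.GeneralisedArithmetic using (fold)
  open import Data.Nat.Tactic.RingSolver using (solve-∀)
  open import Data.Fin as Fin using (Fin; toℕ; fromℕ<; punchOut)
  open import Data.Fin.Properties using (toℕ-fromℕ<; toℕ-injective; toℕ<n; any?; punchOut-injective; injective⇒≤)
  open import Data.Fin.Permutation using (Permutation; permutation)
  open import Data.Product using (_×_; _,_; ∃; proj₁; proj₂)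
  open import Data.Sum using (_⊎_; inj₁; inj₂)
  open import Data.Empty using (⊥-elim)
  open import Relation.Nullary using (¬_; yes; no)
  open import Relation.Binary.PropositionalEquality
  open import Relation.Binary.Definitions using (tri<; tri≈; tri>)

  injective⇒surjective : ∀ {n} (f : Fin n → Fin n) → (∀ {a b} → f a ≡ f b → a ≡ b) →
    ∀ i → ∃ λ j → f j ≡ i
  injective⇒surjective {suc n} f inj i with any? (λ j → f j Fin.≟ i)
  ... | yes hit = hit
  ... | no miss = ⊥-elim (1+n≰n (injective⇒≤ {f = g} g-injective))
    where
    avoids : ∀ j → ¬ i ≡ f j
    avoids j e = miss (j , sym e)
    g : Fin (suc n) → Fin n
    g j = punchOut (avoids j)
    g-injective : ∀ {a b} → g a ≡ g b → a ≡ b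
    g-injective e = inj (punchOut-injective (avoids _) (avoids _) e)

  injective⇒permutation : ∀ {n} (f : Fin n → Fin n) → (∀ {a b} → f a ≡ f b → a ≡ b) → Permutation n n
  injective⇒permutation f inj = permutation f (λ i → proj₁ (surj i)) (λ i → proj₂ (surj i))
      (λ x → inj (proj₂ (surj (f x))))
    where
    surj : ∀ i → ∃ λ j → f j ≡ i
    surj = injective⇒surjective f inj

  %-≡⇒∣∸ : ∀ x y h .{{_ : NonZero h}} → x % h ≡ y % h → x ≤ y → h ∣ y ∸ x
  %-≡⇒∣∸ x y h e le = divides (y / h ∸ x / h) (begin
      y ∸ x                                     ≡⟨ cong₂ _∸_ (m≡m%n+[m/n]*n y h) (m≡m%n+[m/n]*n x h) ⟩
      (y % h + y / h * h) ∸ (x % h + x / h * h) ≡⟨ cong (λ z → (y % h + y / h * h) ∸ (z + x / h * h)) e ⟩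
      (y % h + y / h * h) ∸ (y % h + x / h * h) ≡⟨ [m+n]∸[m+o]≡n∸o (y % h) _ _ ⟩
      y / h * h ∸ x / h * h                     ≡⟨ *-distribʳ-∸ h (y / h) (x / h) ⟨
      (y / h ∸ x / h) * h                       ∎)
    where open ≡-Reasoning

  %-absorbˡ : ∀ x y h .{{_ : NonZero h}} → (x % h + y) % h ≡ (x + y) % h
  %-absorbˡ x y h = begin
      (x % h + y) % h           ≡⟨ %-distribˡ-+ (x % h) y h ⟩
      (x % h % h + y % h) % h   ≡⟨ cong (λ z → (z + y % h) % h) (m%n%n≡m%n x h) ⟩
      (x % h + y % h) % h       ≡⟨ %-distribˡ-+ x y h ⟨
      (x + y) % h               ∎
    where open ≡-Reasoning

  ≡k-mod-small : ∀ k x → x % suc k ≡ k → x ≤ k + k → x ≡ k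
  ≡k-mod-small k x e le with x / suc k | m≡m%n+[m/n]*n x (suc k)
  ... | zero  | eq = trans eq (trans (cong (_+ 0) e) (+-identityʳ k))
  ... | suc q | eq = ⊥-elim (≤⇒≯ le (begin-strict
      k + k                       <⟨ +-monoʳ-< k (n<1+n k) ⟩
      k + suc k                   ≤⟨ +-monoʳ-≤ k (m≤m+n (suc k) (q * suc k)) ⟩
      k + suc q * suc k           ≡⟨ cong (_+ suc q * suc k) e ⟨
      x % suc k + suc q * suc k   ≡⟨ eq ⟨
      x                           ∎))
    where open ≤-Reasoning

  complement-mod : ∀ k A B → A + B ≡ k + suc k → k ∸ A % suc k ≡ B % suc k
  complement-mod k A B eAB = subst (λ z → z ∸ r ≡ q) residues-sum (m+n∸m≡n r q)
    where
    r q : ℕ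
    r = A % suc k
    q = B % suc k
    sum-mod : (r + q) % suc k ≡ k
    sum-mod = begin
      (r + q) % suc k     ≡⟨ %-distribˡ-+ A B (suc k) ⟨
      (A + B) % suc k     ≡⟨ cong (_% suc k) eAB ⟩
      (k + suc k) % suc k ≡⟨ [m+n]%n≡m%n k (suc k) ⟩
      k % suc k           ≡⟨ m<n⇒m%n≡m (n<1+n k) ⟩
      k                   ∎
      where open ≡-Reasoning
    residues-sum : r + q ≡ k
    residues-sum = ≡k-mod-small k (r + q) sum-mod
      (+-mono-≤ (s≤s⁻¹ (m%n<n A (suc k))) (s≤s⁻¹ (m%n<n B (suc k))))
  -- One block x_{n,m}, h = n + m, in 0-based positions j (position j is
  -- e_{h−j}).  Column j has a single nonzero entry ε^(blockExp n h j), in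
  -- row blockRow n h j; these are exactly the quantities used by xmat.
  blockRow : (n h : ℕ) → Fin h → Fin h
  blockRow n (suc k) j = fromℕ< (s≤s (m∸n≤m k ((suc k ∸ toℕ j + n ∸ 1) % suc k)))

  blockExp : (n h : ℕ) → Fin h → ℕ
  blockExp n (suc k) j = (suc k ∸ toℕ j + n ∸ 1) / suc k

  index-simplify : ∀ k (j : Fin (suc k)) n → suc k ∸ toℕ j + n ∸ 1 ≡ k ∸ toℕ j + n
  index-simplify k j n = cong (λ z → z + n ∸ 1) (+-∸-assoc 1 (s≤s⁻¹ (toℕ<n j)))

  blockRow-toℕ : ∀ {n m k} → n + m ≡ suc k → (j : Fin (suc k)) →
    toℕ (blockRow n (suc k) j) ≡ (toℕ j + m) % suc k
  blockRow-toℕ {n} {m} {k} e j = begin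
      toℕ (blockRow n (suc k) j)             ≡⟨ toℕ-fromℕ< _ ⟩
      k ∸ (suc k ∸ toℕ j + n ∸ 1) % suc k    ≡⟨ cong (λ z → k ∸ z % suc k) (index-simplify k j n) ⟩
      k ∸ (k ∸ toℕ j + n) % suc k            ≡⟨ complement-mod k (k ∸ toℕ j + n) (toℕ j + m) total ⟩
      (toℕ j + m) % suc k                    ∎
    where
    open ≡-Reasoning
    j≤k : toℕ j ≤ k
    j≤k = s≤s⁻¹ (toℕ<n j)
    regroup : ∀ a n j m → (a + n) + (j + m) ≡ (a + j) + (n + m)
    regroup = solve-∀
    total : (k ∸ toℕ j + n) + (toℕ j + m) ≡ k + suc k
    total = trans (regroup (k ∸ toℕ j) n (toℕ j) m) (cong₂ _+_ (m∸n+n≡m j≤k) e)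

  blockExp-cases : ∀ {n m h} → n + m ≡ h → (j : Fin h) →
    (toℕ j < n × blockExp n h j ≡ 1) ⊎ (n ≤ toℕ j × blockExp n h j ≡ 0)
  blockExp-cases {n} {m} {suc k} e j with toℕ j <? n
  ... | yes j<n = inj₁ (j<n , trans (cong (_/ suc k) (index-simplify k j n))
                        (trans (m/n≡1+[m∸n]/n h≤A) (cong suc (m<n⇒m/n≡0 A∸h<h))))
    where
    A : ℕ
    A = k ∸ toℕ j + n
    j≤k : toℕ j ≤ k
    j≤k = s≤s⁻¹ (toℕ<n j)
    h≤A : suc k ≤ A
    h≤A = ≤-trans (≤-reflexive (sym (trans (+-suc (k ∸ toℕ j) (toℕ j)) (cong suc (m∸n+n≡m j≤k)))))
                  (+-monoʳ-≤ (k ∸ toℕ j) j<n)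
    A<2h : A < suc k + suc k
    A<2h = begin-strict
        k ∸ toℕ j + n ≤⟨ +-monoˡ-≤ n (m∸n≤m k (toℕ j)) ⟩
        k + n         ≤⟨ +-monoʳ-≤ k (≤-trans (m≤m+n n m) (≤-reflexive e)) ⟩
        k + suc k     <⟨ n<1+n _ ⟩
        suc k + suc k ∎
      where open ≤-Reasoning
    A∸h<h : A ∸ suc k < suc k
    A∸h<h = +-cancelʳ-< (suc k) (A ∸ suc k) (suc k) (subst (_< suc k + suc k) (sym (m∸n+n≡m h≤A)) A<2h)
  ... | no j≮n = inj₂ (n≤j , trans (cong (_/ suc k) (index-simplify k j n)) (m<n⇒m/n≡0 (s≤s A≤k)))
    where
    n≤j : n ≤ toℕ j
    n≤j = ≮⇒≥ j≮n
    A≤k : k ∸ toℕ j + n ≤ k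
    A≤k = begin
        k ∸ toℕ j + n ≤⟨ +-monoˡ-≤ n (∸-monoʳ-≤ k n≤j) ⟩
        k ∸ n + n     ≡⟨ m∸n+n≡m (≤-trans n≤j (s≤s⁻¹ (toℕ<n j))) ⟩
        k             ∎
      where open ≤-Reasoning

  blockRow-injective : ∀ {n m h} → n + m ≡ h → ∀ {a b : Fin h} → blockRow n h a ≡ blockRow n h b → a ≡ b
  blockRow-injective {n} {m} {suc k} e {a} {b} eq =
    toℕ-injective (trans (sym (undo a)) (trans (cong (λ z → (z + n) % suc k) rotated) (undo b)))
    where
    rotated : (toℕ a + m) % suc k ≡ (toℕ b + m) % suc k
    rotated = trans (sym (blockRow-toℕ e a)) (trans (cong toℕ eq) (blockRow-toℕ e b))
    undo : ∀ (j : Fin (suc k)) → ((toℕ j + m) % suc k + n) % suc k ≡ toℕ j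
    undo j = begin
        ((toℕ j + m) % suc k + n) % suc k ≡⟨ %-absorbˡ (toℕ j + m) n (suc k) ⟩
        (toℕ j + m + n) % suc k           ≡⟨ cong (_% suc k) (trans (+-assoc (toℕ j) m n) (cong (toℕ j +_) (trans (+-comm m n) e))) ⟩
        (toℕ j + suc k) % suc k           ≡⟨ [m+n]%n≡m%n (toℕ j) (suc k) ⟩
        toℕ j % suc k                     ≡⟨ m<n⇒m%n≡m (toℕ<n j) ⟩
        toℕ j                             ∎
      where open ≡-Reasoning

  -- The first position of a (necessarily nonempty) block, given any of its
  -- positions.
  firstOf : ∀ {h} → Fin h → Fin h
  firstOf {suc k} _ = Fin.zero

  firstOf-const : ∀ {h} (a b : Fin h) → firstOf a ≡ firstOf b
  firstOf-const {suc k} a b = refl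

  orbit-toℕ : ∀ {n m k} → n + m ≡ suc k → ∀ d →
    toℕ (fold Fin.zero (blockRow n (suc k)) d) ≡ (d * m) % suc k
  orbit-toℕ e zero = refl
  orbit-toℕ {n} {m} {k} e (suc d) = begin
      toℕ (blockRow n (suc k) (fold Fin.zero (blockRow n (suc k)) d)) ≡⟨ blockRow-toℕ {n} {m} e (fold Fin.zero (blockRow n (suc k)) d) ⟩
      (toℕ (fold Fin.zero (blockRow n (suc k)) d) + m) % suc k       ≡⟨ cong (λ z → (z + m) % suc k) (orbit-toℕ e d) ⟩
      ((d * m) % suc k + m) % suc k                                   ≡⟨ %-absorbˡ (d * m) m (suc k) ⟩
      (d * m + m) % suc k                                             ≡⟨ cong (_% suc k) (+-comm (d * m) m) ⟩
      (m + d * m) % suc k                                             ∎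
    where open ≡-Reasoning

  orbit-distinct : ∀ {n m k} → n + m ≡ suc k → Coprime (suc k) m → ∀ {d d′} → d < d′ → d′ < suc k →
    ¬ fold Fin.zero (blockRow n (suc k)) d ≡ fold Fin.zero (blockRow n (suc k)) d′
  orbit-distinct {n} {m} {k} e cop {d} {d′} d<d′ d′<h eq =
    <⇒≱ (≤-<-trans (m∸n≤m d′ d) d′<h) (∣⇒≤ ⦃ >-nonZero (m<n⇒0<n∸m d<d′) ⦄ h∣d′∸d)
    where
    same-residue : (d * m) % suc k ≡ (d′ * m) % suc k
    same-residue = trans (sym (orbit-toℕ e d)) (trans (cong toℕ eq) (orbit-toℕ e d′))
    h∣m[d′∸d] : suc k ∣ m * (d′ ∸ d)
    h∣m[d′∸d] = subst (suc k ∣_) (trans (sym (*-distribʳ-∸ m d′ d)) (*-comm (d′ ∸ d) m))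
      (%-≡⇒∣∸ (d * m) (d′ * m) (suc k) same-residue (*-monoˡ-≤ m (<⇒≤ d<d′)))
    h∣d′∸d : suc k ∣ d′ ∸ d
    h∣d′∸d = coprime-divisor cop h∣m[d′∸d]

  rotation-transitive : ∀ {n m h} → n + m ≡ h → Coprime h m → (i : Fin h) →
    ∃ λ d → d < h × fold (firstOf i) (blockRow n h) d ≡ i
  rotation-transitive {n} {m} {suc k} e cop i
    with injective⇒surjective orbit orbit-injective i
    where
    orbit : Fin (suc k) → Fin (suc k)
    orbit d = fold Fin.zero (blockRow n (suc k)) (toℕ d)
    orbit-injective : ∀ {a b} → orbit a ≡ orbit b → a ≡ b
    orbit-injective {a} {b} eq with <-cmp (toℕ a) (toℕ b)
    ... | tri< a<b _ _ = ⊥-elim (orbit-distinct e cop a<b (toℕ<n b) eq)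
    ... | tri≈ _ a≡b _ = toℕ-injective a≡b
    ... | tri> _ _ b<a = ⊥-elim (orbit-distinct e cop b<a (toℕ<n a) (sym eq))
  ... | d , eq = toℕ d , toℕ<n d , eq

module Polygon where

  open import Defs
  open Cycle
  open import Data.Nat as ℕ using (ℕ; zero; suc; _≤_; _<_; _<ᵇ_)
  import Data.Nat.Properties as ℕP
  open import Data.Integer as ℤ using (ℤ; +_)
  import Data.Integer.Properties as ℤP
  open import Data.Integer.Tactic.RingSolver using (solve-∀)
  import Algebra.Properties.CommutativeMonoid.Sum as CommutativeMonoidSum
  open import Data.Fin as Fin using (Fin; toℕ; _↑ˡ_; _↑ʳ_; splitAt)
  open import Data.Fin.Properties using (all?; toℕ-fromℕ<; splitAt-↑ˡ; splitAt-↑ʳ; splitAt⁻¹-↑ˡ; splitAt⁻¹-↑ʳ; ↑ˡ-injective; ↑ʳ-injective; toℕ-↑ˡ; toℕ-↑ʳ; toℕ<n)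
  open import Data.Fin.Permutation as Perm using (Permutation; _⟨$⟩ʳ_)
  open import Data.Rational using (ℚ)
  open import Data.List using (List; []; _∷_)
  open import Data.Bool using (Bool; true; false; if_then_else_)
  open import Data.Product using (_,_; Σ)
  open import Data.Sum using (_⊎_; inj₁; inj₂)
  open import Data.Empty using (⊥-elim)
  open import Relation.Nullary using (¬_; Dec; does)
  open import Relation.Nullary.Decidable using (_⊎-dec_)
  open import Relation.Nullary.Reflects using (ofʸ; ofⁿ)
  open import Relation.Binary.PropositionalEquality

  data BlockView (a b : ℕ) : Fin (a ℕ.+ b) → Set where
    inFirst : ∀ x → BlockView a b (x ↑ˡ b)
    inRest  : ∀ y → BlockView a b (a ↑ʳ y)

  blockView : ∀ a b (i : Fin (a ℕ.+ b)) → BlockView a b i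
  blockView a b i with splitAt a i in e
  ... | inj₁ x = subst (BlockView a b) (splitAt⁻¹-↑ˡ e) (inFirst x)
  ... | inj₂ y = subst (BlockView a b) (splitAt⁻¹-↑ʳ e) (inRest y)

  ↑ˡ≢↑ʳ : ∀ {a b} (x : Fin a) (y : Fin b) → ¬ (x ↑ˡ b) ≡ (a ↑ʳ y)
  ↑ˡ≢↑ʳ {a} {b} x y e = ℕP.<⇒≱ (subst (_< a) (sym (toℕ-↑ˡ x b)) (toℕ<n x))
    (subst (a ≤_) (trans (sym (toℕ-↑ʳ a y)) (cong toℕ (sym e))) (ℕP.m≤m+n a (toℕ y)))

  rowOf : (P : List ℚ) → Fin (hP P) → Fin (hP P)
  rowOf (ν ∷ P) j with splitAt (hν ν) j
  ... | inj₁ a = blockRow (nν ν) (hν ν) a ↑ˡ hP P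
  ... | inj₂ b = hν ν ↑ʳ rowOf P b

  rowExp : (P : List ℚ) → Fin (hP P) → ℕ
  rowExp (ν ∷ P) j with splitAt (hν ν) j
  ... | inj₁ a = blockExp (nν ν) (hν ν) a
  ... | inj₂ b = rowExp P b

  rowOf-first : ∀ ν P a → rowOf (ν ∷ P) (a ↑ˡ hP P) ≡ blockRow (nν ν) (hν ν) a ↑ˡ hP P
  rowOf-first ν P a rewrite splitAt-↑ˡ (hν ν) a (hP P) = refl

  rowOf-rest : ∀ ν P b → rowOf (ν ∷ P) (hν ν ↑ʳ b) ≡ hν ν ↑ʳ rowOf P b
  rowOf-rest ν P b rewrite splitAt-↑ʳ (hν ν) (hP P) b = refl

  rowExp-first : ∀ ν P a → rowExp (ν ∷ P) (a ↑ˡ hP P) ≡ blockExp (nν ν) (hν ν) a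
  rowExp-first ν P a rewrite splitAt-↑ˡ (hν ν) a (hP P) = refl

  rowExp-rest : ∀ ν P b → rowExp (ν ∷ P) (hν ν ↑ʳ b) ≡ rowExp P b
  rowExp-rest ν P b rewrite splitAt-↑ʳ (hν ν) (hP P) b = refl

  rowOf-injective : ∀ P {i j} → rowOf P i ≡ rowOf P j → i ≡ j
  rowOf-injective (ν ∷ P) {i} {j} e with blockView (hν ν) (hP P) i | blockView (hν ν) (hP P) j
  ... | inFirst x | inFirst y = cong (_↑ˡ hP P) (blockRow-injective {m = mν ν} refl
         (↑ˡ-injective (hP P) _ _ (trans (sym (rowOf-first ν P x)) (trans e (rowOf-first ν P y)))))
  ... | inFirst x | inRest y  = ⊥-elim (↑ˡ≢↑ʳ _ _ (trans (sym (rowOf-first ν P x)) (trans e (rowOf-rest ν P y))))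
  ... | inRest x  | inFirst y = ⊥-elim (↑ˡ≢↑ʳ _ _ (trans (sym (rowOf-first ν P y)) (trans (sym e) (rowOf-rest ν P x))))
  ... | inRest x  | inRest y  = cong (hν ν ↑ʳ_) (rowOf-injective P
         (↑ʳ-injective (hν ν) _ _ (trans (sym (rowOf-rest ν P x)) (trans e (rowOf-rest ν P y)))))

  rowPerm : (P : List ℚ) → Permutation (hP P) (hP P)
  rowPerm P = injective⇒permutation (rowOf P) (rowOf-injective P)

  rowExp-cases : ∀ P j → rowExp P j ≡ 0 ⊎ rowExp P j ≡ 1
  rowExp-cases (ν ∷ P) j with blockView (hν ν) (hP P) j
  ... | inFirst x with blockExp-cases {m = mν ν} refl x
  ...   | inj₁ (_ , e) = inj₂ (trans (rowExp-first ν P x) e)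
  ...   | inj₂ (_ , e) = inj₁ (trans (rowExp-first ν P x) e)
  rowExp-cases (ν ∷ P) j | inRest y = subst (λ z → z ≡ 0 ⊎ z ≡ 1) (sym (rowExp-rest ν P y)) (rowExp-cases P y)

  open CommutativeMonoidSum ℤP.+-0-commutativeMonoid
    using (sum; sum-cong-≗; ∑-distrib-+; sum-permute; sum-replicate-zero)

  sum-split : ∀ a b (f : Fin (a ℕ.+ b) → ℤ) → sum f ≡ sum (λ j → f (j ↑ˡ b)) ℤ.+ sum (λ j → f (a ↑ʳ j))
  sum-split zero    b f = sym (ℤP.+-identityˡ _)
  sum-split (suc a) b f = trans (cong (λ x → f Fin.zero ℤ.+ x) (sum-split a b (λ j → f (Fin.suc j))))
    (sym (ℤP.+-assoc (f Fin.zero) _ _))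

  sum-neg : ∀ {n} (f : Fin n → ℤ) → sum (λ j → ℤ.- f j) ≡ ℤ.- sum f
  sum-neg {zero}  f = refl
  sum-neg {suc n} f = trans (cong (λ x → ℤ.- f Fin.zero ℤ.+ x) (sum-neg (λ j → f (Fin.suc j))))
    (sym (ℤP.neg-distrib-+ (f Fin.zero) _))

  count : ∀ {n} → (Fin n → Bool) → ℕ
  count {zero}  b = 0
  count {suc n} b = (if b Fin.zero then 1 else 0) ℕ.+ count (λ j → b (Fin.suc j))

  count-≤ : ∀ {n} (b : Fin n → Bool) → count b ≤ n
  count-≤ {zero}  b = ℕ.z≤n
  count-≤ {suc n} b with b Fin.zero
  ... | true  = ℕ.s≤s (count-≤ (λ j → b (Fin.suc j)))
  ... | false = ℕP.m≤n⇒m≤1+n (count-≤ (λ j → b (Fin.suc j)))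

  sortingPermutation : ∀ n (b : Fin n → Bool) →
    Σ (Permutation n n) λ w → ∀ j → (toℕ (w ⟨$⟩ʳ j) <ᵇ count b) ≡ b j
  sortingPermutation zero    b = Perm.id , λ ()
  sortingPermutation (suc n) b with sortingPermutation n (λ j → b (Fin.suc j)) | b Fin.zero in b₀
  ... | w , sorts | true  = Perm.lift₀ w , sorted
    where
    sorted : ∀ j → (toℕ (Perm.lift₀ w ⟨$⟩ʳ j) <ᵇ suc (count (λ j → b (Fin.suc j)))) ≡ b j
    sorted Fin.zero    = sym b₀
    sorted (Fin.suc j) = sorts j
  ... | w , sorts | false = Perm.insert Fin.zero slot w , sorted
    where
    c : ℕ
    c = count (λ j → b (Fin.suc j))
    slot : Fin (suc n)
    slot = Fin.fromℕ< (ℕ.s≤s (count-≤ (λ j → b (Fin.suc j))))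
    slot-toℕ : toℕ slot ≡ c
    slot-toℕ = toℕ-fromℕ< _
    punchIn-below : ∀ {n} (p : Fin (suc n)) (x : Fin n) → (toℕ (Fin.punchIn p x) <ᵇ toℕ p) ≡ (toℕ x <ᵇ toℕ p)
    punchIn-below Fin.zero    x           = refl
    punchIn-below (Fin.suc p) Fin.zero    = refl
    punchIn-below (Fin.suc p) (Fin.suc x) = punchIn-below p x
    sorted : ∀ j → (toℕ (Perm.insert Fin.zero slot w ⟨$⟩ʳ j) <ᵇ c) ≡ b j
    sorted Fin.zero    = trans (cong (_<ᵇ c) slot-toℕ) (trans (<ᵇ-irrefl c) (sym b₀))
      where
      <ᵇ-irrefl : ∀ c → (c <ᵇ c) ≡ false
      <ᵇ-irrefl zero    = refl
      <ᵇ-irrefl (suc c) = <ᵇ-irrefl c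
    sorted (Fin.suc j) = begin
        (toℕ (Perm.insert Fin.zero slot w ⟨$⟩ʳ Fin.suc j) <ᵇ c) ≡⟨ cong (λ z → toℕ z <ᵇ c) (Perm.insert-punchIn Fin.zero slot w j) ⟩
        (toℕ (Fin.punchIn slot (w ⟨$⟩ʳ j)) <ᵇ c)               ≡⟨ subst (λ z → (toℕ (Fin.punchIn slot (w ⟨$⟩ʳ j)) <ᵇ z) ≡ (toℕ (w ⟨$⟩ʳ j) <ᵇ z))
                                                                     slot-toℕ (punchIn-below slot (w ⟨$⟩ʳ j)) ⟩
        (toℕ (w ⟨$⟩ʳ j) <ᵇ c)                                  ≡⟨ sorts j ⟩
        b (Fin.suc j)                                          ∎
      where open ≡-Reasoning

  sum-indicator : ∀ {n} (f : Fin n → ℤ) (b : Fin n → Bool) →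
    (∀ j → f j ≡ (if b j then + 1 else + 0)) → sum f ≡ + count b
  sum-indicator {zero}  f b e = refl
  sum-indicator {suc n} f b e =
    trans (cong₂ ℤ._+_ (e Fin.zero) (sum-indicator _ _ (λ j → e (Fin.suc j)))) (first-term (b Fin.zero))
    where
    first-term : ∀ x {c} → (if x then + 1 else + 0) ℤ.+ + c ≡ + ((if x then 1 else 0) ℕ.+ c)
    first-term true  = refl
    first-term false = refl

  sum-blockExp : ∀ n m → sum (λ j → + blockExp n (n ℕ.+ m) j) ≡ + n
  sum-blockExp n m = trans (sum-cong-≗ as-indicator) (first-n n)
    where
    as-indicator : ∀ j → + blockExp n (n ℕ.+ m) j ≡ + (if toℕ j <ᵇ n then 1 else 0)
    as-indicator j with toℕ j <ᵇ n | ℕP.<ᵇ-reflects-< (toℕ j) n | blockExp-cases {n} {m} refl j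
    ... | true  | _        | inj₁ (_ , e)   = cong +_ e
    ... | false | _        | inj₂ (_ , e)   = cong +_ e
    ... | true  | ofʸ j<n  | inj₂ (n≤j , _) = ⊥-elim (ℕP.<⇒≱ j<n n≤j)
    ... | false | ofⁿ j≮n  | inj₁ (j<n , _) = ⊥-elim (j≮n j<n)
    first-n : ∀ n → sum {n ℕ.+ m} (λ j → + (if toℕ j <ᵇ n then 1 else 0)) ≡ + n
    first-n zero    = trans (sum-cong-≗ {m} (λ _ → refl)) (sum-replicate-zero m)
    first-n (suc n) = cong (λ x → + 1 ℤ.+ x) (first-n n)

  sum-rowExp : ∀ P → sum (λ j → + rowExp P j) ≡ + sP P
  sum-rowExp []      = refl
  sum-rowExp (ν ∷ P) = begin
      sum (λ j → + rowExp (ν ∷ P) j)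
        ≡⟨ sum-split (hν ν) (hP P) _ ⟩
      sum (λ j → + rowExp (ν ∷ P) (j ↑ˡ hP P)) ℤ.+ sum (λ j → + rowExp (ν ∷ P) (hν ν ↑ʳ j))
        ≡⟨ cong₂ ℤ._+_ (sum-cong-≗ (λ j → cong +_ (rowExp-first ν P j))) (sum-cong-≗ (λ j → cong +_ (rowExp-rest ν P j))) ⟩
      sum (λ j → + blockExp (nν ν) (hν ν) j) ℤ.+ sum (λ j → + rowExp P j)
        ≡⟨ cong₂ ℤ._+_ (sum-blockExp (nν ν) (mν ν)) (sum-rowExp P) ⟩
      + sP (ν ∷ P) ∎
    where open ≡-Reasoning

  -- Cocharacters constant on blocks are invariant under the row permutation,
  -- since it preserves every block.
  constOnBlocks-rowOf : ∀ P {c : Cochar (hP P)} → ConstOnBlocks P c → ∀ j → c (rowOf P j) ≡ c j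
  constOnBlocks-rowOf (ν ∷ P) {c} (c-first , c-rest) j with blockView (hν ν) (hP P) j
  ... | inFirst x = trans (cong c (rowOf-first ν P x)) (c-first _ _)
  ... | inRest y  = trans (cong c (rowOf-rest ν P y)) (constOnBlocks-rowOf P c-rest y)

  -- ε^{-λ} x_𝒫 ε^λ is monomial with the same rows as x_𝒫; the exponent of
  -- its entry in column j is rowExp j + λ_j − λ_{rowOf j}.
  exponent : ∀ P → Cochar (hP P) → Fin (hP P) → ℤ
  exponent P l j = (+ rowExp P j ℤ.+ l j) ℤ.- l (rowOf P j)

  -- All exponents lie in {0, 1}; this will characterise X_*(T)^𝒫.
  Admissible : ∀ P → Cochar (hP P) → Set
  Admissible P l = ∀ j → exponent P l j ≡ + 0 ⊎ exponent P l j ≡ + 1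

  admissible? : ∀ P l → Dec (Admissible P l)
  admissible? P l = all? (λ j → (exponent P l j ℤ.≟ + 0) ⊎-dec (exponent P l j ℤ.≟ + 1))

  admissible-cong : ∀ P {l l′} → (∀ i → l i ≡ l′ i) → Admissible P l → Admissible P l′
  admissible-cong P {l} {l′} e adm j rewrite sym (e j) | sym (e (rowOf P j)) = adm j

  exponent-shift : ∀ P l c → ConstOnBlocks P c → ∀ j → exponent P (l +ᶜ c) j ≡ exponent P l j
  exponent-shift P l c c-const j =
    trans (cong (λ z → (+ rowExp P j ℤ.+ (l j ℤ.+ c j)) ℤ.- (l (rowOf P j) ℤ.+ z)) (constOnBlocks-rowOf P c-const j))
          (cancel (+ rowExp P j) (l j) (c j) (l (rowOf P j)))
    where
    cancel : ∀ a x y z → (a ℤ.+ (x ℤ.+ y)) ℤ.- (z ℤ.+ y) ≡ (a ℤ.+ x) ℤ.- z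
    cancel = solve-∀

  admissible-shift : ∀ P l c → ConstOnBlocks P c → Admissible P l → Admissible P (l +ᶜ c)
  admissible-shift P l c c-const adm j rewrite exponent-shift P l c c-const j = adm j

  -- Whatever λ is, the exponents add up to s: the λ-terms cancel because
  -- rowOf is a permutation.
  sum-exponent : ∀ P l → sum (exponent P l) ≡ + sP P
  sum-exponent P l = begin
      sum (exponent P l)
        ≡⟨ ∑-distrib-+ (λ j → + rowExp P j ℤ.+ l j) (λ j → ℤ.- l (rowOf P j)) ⟩
      sum (λ j → + rowExp P j ℤ.+ l j) ℤ.+ sum (λ j → ℤ.- l (rowOf P j))
        ≡⟨ cong₂ ℤ._+_ (∑-distrib-+ (λ j → + rowExp P j) l) (sum-neg (λ j → l (rowOf P j))) ⟩
      (sum (λ j → + rowExp P j) ℤ.+ sum l) ℤ.- sum (λ j → l (rowOf P j))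
        ≡⟨ cong (λ z → (sum (λ j → + rowExp P j) ℤ.+ sum l) ℤ.- z) (sum-permute l (rowPerm P)) ⟨
      (sum (λ j → + rowExp P j) ℤ.+ sum l) ℤ.- sum l
        ≡⟨ cancel _ _ ⟩
      sum (λ j → + rowExp P j)
        ≡⟨ sum-rowExp P ⟩
      + sP P ∎
    where
    open ≡-Reasoning
    cancel : ∀ a x → (a ℤ.+ x) ℤ.- x ≡ a
    cancel = solve-∀

  isOne : ∀ P → Cochar (hP P) → Fin (hP P) → Bool
  isOne P l j = does (exponent P l j ℤ.≟ + 1)

  count-isOne : ∀ P l → Admissible P l → count (isOne P l) ≡ sP P
  count-isOne P l adm = ℤP.+-injective (trans (sym (sum-indicator (exponent P l) (isOne P l) zero-one)) (sum-exponent P l))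
    where
    zero-one : ∀ j → exponent P l j ≡ (if isOne P l j then + 1 else + 0)
    zero-one j with adm j
    ... | inj₁ e rewrite e = refl
    ... | inj₂ e rewrite e = refl

module Finiteness where

  open import Defs
  open Cycle
  open Polygon
  open import Data.Nat as ℕ using (ℕ; zero; suc; _≤_; z≤n; s≤s)
  import Data.Nat.Properties as ℕP
  open import Data.Nat.GeneralisedArithmetic using (fold)
  open import Data.Nat.Coprimality using (Coprime)
  open import Data.Integer as ℤ using (ℤ; +_; -[1+_]; ∣_∣)
  import Data.Integer.Properties as ℤP
  open import Data.Integer.Tactic.RingSolver using (solve-∀)
  open import Data.Fin as Fin using (Fin; _↑ˡ_; _↑ʳ_; splitAt)
  open import Data.Fin.Properties using (splitAt-↑ˡ; splitAt-↑ʳ)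
  open import Data.Rational using (ℚ)
  open import Data.List using (List; []; _∷_; cartesianProductWith; filter)
  open import Data.List.Relation.Unary.All using (All; []; _∷_)
  open import Data.List.Relation.Unary.Any as Any using (Any; here; there)
  open import Data.List.Relation.Unary.Any.Properties using (cartesianProductWith⁺; filter⁺; lookup-result)
  open import Data.List.Relation.Unary.All.Properties using (all-filter)
  open import Data.List.Membership.Propositional using (_∈_)
  open import Data.Product using (_×_; _,_; ∃; Σ)
  open import Data.Sum using (_⊎_; inj₁; inj₂)
  open import Data.Empty using (⊥-elim)
  open import Data.Unit.Polymorphic using (tt)
  open import Relation.Nullary using (yes; no)
  open import Relation.Binary.PropositionalEquality

  constOnBlocks-cong : ∀ P {f g : Cochar (hP P)} → (∀ i → f i ≡ g i) → ConstOnBlocks P f → ConstOnBlocks P g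
  constOnBlocks-cong []      e c = tt
  constOnBlocks-cong (ν ∷ P) e (c-first , c-rest) =
    (λ a b → trans (sym (e _)) (trans (c-first a b) (e _))) , constOnBlocks-cong P (λ i → e _) c-rest

  constOnBlocks-map : ∀ P (F : ℤ → ℤ) {f : Cochar (hP P)} → ConstOnBlocks P f → ConstOnBlocks P (λ i → F (f i))
  constOnBlocks-map []      F c = tt
  constOnBlocks-map (ν ∷ P) F (c-first , c-rest) = (λ a b → cong F (c-first a b)) , constOnBlocks-map P F c-rest

  firstValues : ∀ P → Cochar (hP P) → Cochar (hP P)
  firstValues (ν ∷ P) l i with splitAt (hν ν) i
  ... | inj₁ a = l (firstOf a ↑ˡ hP P)
  ... | inj₂ b = firstValues P (λ x → l (hν ν ↑ʳ x)) b

  firstValues-first : ∀ ν P l a → firstValues (ν ∷ P) l (a ↑ˡ hP P) ≡ l (firstOf a ↑ˡ hP P)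
  firstValues-first ν P l a rewrite splitAt-↑ˡ (hν ν) a (hP P) = refl

  firstValues-rest : ∀ ν P l b → firstValues (ν ∷ P) l (hν ν ↑ʳ b) ≡ firstValues P (λ x → l (hν ν ↑ʳ x)) b
  firstValues-rest ν P l b rewrite splitAt-↑ʳ (hν ν) (hP P) b = refl

  firstValues-const : ∀ P l → ConstOnBlocks P (firstValues P l)
  firstValues-const []      l = tt
  firstValues-const (ν ∷ P) l =
    (λ a b → trans (firstValues-first ν P l a)
               (trans (cong (λ z → l (z ↑ˡ hP P)) (firstOf-const a b)) (sym (firstValues-first ν P l b))))
    , constOnBlocks-cong P (λ i → sym (firstValues-rest ν P l i)) (firstValues-const P (λ x → l (hν ν ↑ʳ x)))

  admissible-rest : ∀ ν P l → Admissible (ν ∷ P) l → Admissible P (λ x → l (hν ν ↑ʳ x))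
  admissible-rest ν P l adm b with adm (hν ν ↑ʳ b)
  ... | r rewrite rowExp-rest ν P b | rowOf-rest ν P b = r

  -- For admissible λ, one step along the row permutation changes λ by at
  -- most 1 (both rowExp and the exponent lie in {0, 1}) ...
  step-bound : ∀ P l → Admissible P l → ∀ j → ∣ l (rowOf P j) ℤ.- l j ∣ ≤ 1
  step-bound P l adm j = subst (λ z → ∣ z ∣ ≤ 1) (sym difference) (bound (rowExp-cases P j) (adm j))
    where
    rearrange : ∀ a x z → z ℤ.- x ≡ a ℤ.- ((a ℤ.+ x) ℤ.- z)
    rearrange = solve-∀
    difference : l (rowOf P j) ℤ.- l j ≡ + rowExp P j ℤ.- exponent P l j
    difference = rearrange (+ rowExp P j) (l j) (l (rowOf P j))
    bound : rowExp P j ≡ 0 ⊎ rowExp P j ≡ 1 → exponent P l j ≡ + 0 ⊎ exponent P l j ≡ + 1 →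
      ∣ + rowExp P j ℤ.- exponent P l j ∣ ≤ 1
    bound (inj₁ a) (inj₁ e) rewrite a | e = z≤n
    bound (inj₁ a) (inj₂ e) rewrite a | e = s≤s z≤n
    bound (inj₂ a) (inj₁ e) rewrite a | e = s≤s z≤n
    bound (inj₂ a) (inj₂ e) rewrite a | e = z≤n

  orbit-bound : ∀ P l → Admissible P l → ∀ d j → ∣ l (fold j (rowOf P) d) ℤ.- l j ∣ ≤ d
  orbit-bound P l adm zero    j = ℕP.≤-reflexive (cong ∣_∣ (ℤP.+-inverseʳ (l j)))
  orbit-bound P l adm (suc d) j = ℕP.≤-trans
      (subst (λ w → ∣ w ∣ ≤ ∣ x ℤ.- y ∣ ℕ.+ ∣ y ℤ.- z ∣) (sym (telescope x y z)) (ℤP.∣i+j∣≤∣i∣+∣j∣ (x ℤ.- y) (y ℤ.- z)))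
      (ℕP.+-mono-≤ (step-bound P l adm (fold j (rowOf P) d)) (orbit-bound P l adm d j))
    where
    x y z : ℤ
    x = l (rowOf P (fold j (rowOf P) d))
    y = l (fold j (rowOf P) d)
    z = l j
    telescope : ∀ x y z → x ℤ.- z ≡ (x ℤ.- y) ℤ.+ (y ℤ.- z)
    telescope = solve-∀

  orbit-first : ∀ ν P d x → fold (x ↑ˡ hP P) (rowOf (ν ∷ P)) d ≡ fold x (blockRow (nν ν) (hν ν)) d ↑ˡ hP P
  orbit-first ν P zero    x = refl
  orbit-first ν P (suc d) x = trans (cong (rowOf (ν ∷ P)) (orbit-first ν P d x)) (rowOf-first ν P _)

  -- The rotations of all blocks are single cycles.
  CoprimeBlocks : List ℚ → Set
  CoprimeBlocks P = All (λ ν → Coprime (hν ν) (mν ν)) P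

  -- Since each block is a single cycle of length h_i, an admissible λ
  -- differs from its first value on each block by at most h.
  firstValues-bound : ∀ P → CoprimeBlocks P → ∀ l → Admissible P l → ∀ i → ∣ l i ℤ.- firstValues P l i ∣ ≤ hP P
  firstValues-bound (ν ∷ P) (cop ∷ cops) l adm i with blockView (hν ν) (hP P) i
  ... | inFirst x with rotation-transitive {m = mν ν} refl cop x
  ...   | d , d<h , reaches = ℕP.≤-trans
            (subst (λ w → ∣ w ∣ ≤ d) (sym along-orbit) (orbit-bound (ν ∷ P) l adm d (firstOf x ↑ˡ hP P)))
            (ℕP.≤-trans (ℕP.<⇒≤ d<h) (ℕP.m≤m+n (hν ν) (hP P)))
    where
    along-orbit : l (x ↑ˡ hP P) ℤ.- firstValues (ν ∷ P) l (x ↑ˡ hP P)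
                ≡ l (fold (firstOf x ↑ˡ hP P) (rowOf (ν ∷ P)) d) ℤ.- l (firstOf x ↑ˡ hP P)
    along-orbit = cong₂ ℤ._-_ (cong l (sym (trans (orbit-first ν P d (firstOf x)) (cong (_↑ˡ hP P) reaches))))
                              (firstValues-first ν P l x)
  firstValues-bound (ν ∷ P) (cop ∷ cops) l adm i | inRest y = ℕP.≤-trans
    (subst (λ w → ∣ l (hν ν ↑ʳ y) ℤ.- w ∣ ≤ hP P) (sym (firstValues-rest ν P l y))
      (firstValues-bound P cops (λ x → l (hν ν ↑ʳ x)) (admissible-rest ν P l adm) y))
    (ℕP.m≤n+m (hP P) (hν ν))

  range : ℕ → List ℤ
  range zero    = + 0 ∷ []
  range (suc n) = + suc n ∷ -[1+ n ] ∷ range n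

  ∈-range : ∀ n z → ∣ z ∣ ≤ n → z ∈ range n
  ∈-range zero    (+ zero) le = here refl
  ∈-range (suc n) (+ k) le with k ℕ.≟ suc n
  ... | yes refl = here refl
  ... | no k≢    = there (there (∈-range n (+ k) (ℕ.s≤s⁻¹ (ℕP.≤∧≢⇒< le k≢))))
  ∈-range (suc n) -[1+ k ] le with k ℕ.≟ n
  ... | yes refl = there (here refl)
  ... | no k≢    = there (there (∈-range n -[1+ k ] (ℕP.≤∧≢⇒< (ℕ.s≤s⁻¹ le) k≢)))

  _∷ᶠ_ : ∀ {n} → ℤ → (Fin n → ℤ) → Fin (suc n) → ℤ
  (v ∷ᶠ f) Fin.zero    = v
  (v ∷ᶠ f) (Fin.suc i) = f i

  functionsInto : ∀ n → List ℤ → List (Fin n → ℤ)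
  functionsInto zero    vs = (λ ()) ∷ []
  functionsInto (suc n) vs = cartesianProductWith _∷ᶠ_ vs (functionsInto n vs)

  functionsInto-complete : ∀ n vs (f : Fin n → ℤ) → (∀ i → f i ∈ vs) →
    Any (λ g → ∀ i → f i ≡ g i) (functionsInto n vs)
  functionsInto-complete zero    vs f f∈ = here (λ ())
  functionsInto-complete (suc n) vs f f∈ =
    cartesianProductWith⁺ _∷ᶠ_ agree (f∈ Fin.zero)
      (functionsInto-complete n vs (λ i → f (Fin.suc i)) (λ i → f∈ (Fin.suc i)))
    where
    agree : ∀ {v g} → f Fin.zero ≡ v → (∀ i → f (Fin.suc i) ≡ g i) → ∀ i → f i ≡ (v ∷ᶠ g) i
    agree e₀ e Fin.zero    = e₀
    agree e₀ e (Fin.suc i) = e i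

  -- Subtracting firstValues
  -- normalises λ to an admissible cocharacter with entries in [−h, h].
  admissible-representatives : ∀ P → CoprimeBlocks P →
    Σ (List (Cochar (hP P))) λ reps → All (Admissible P) reps ×
      (∀ l → Admissible P l →
         Any (λ r → ∃ λ c′ → ConstOnBlocks P c′ × (∀ i → l i ≡ (r +ᶜ c′) i)) reps)
  admissible-representatives P cops = reps , all-filter (admissible? P) candidates , represented
    where
    candidates reps : List (Cochar (hP P))
    candidates = functionsInto (hP P) (range (hP P))
    reps = filter (admissible? P) candidates
    represented : ∀ l → Admissible P l →
      Any (λ r → ∃ λ c′ → ConstOnBlocks P c′ × (∀ i → l i ≡ (r +ᶜ c′) i)) reps
    represented l adm = Any.map (λ r≗ → firstValues P l , firstValues-const P l , λ i → shift-back i r≗) found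
      where
      normalised : Cochar (hP P)
      normalised = l +ᶜ (λ i → ℤ.- firstValues P l i)
      normalised-admissible : Admissible P normalised
      normalised-admissible =
        admissible-shift P l _ (constOnBlocks-map P ℤ.-_ (firstValues-const P l)) adm
      listed : Any (λ g → ∀ i → normalised i ≡ g i) candidates
      listed = functionsInto-complete (hP P) (range (hP P)) normalised
        (λ i → ∈-range (hP P) (normalised i) (firstValues-bound P cops l adm i))
      found : Any (λ g → ∀ i → normalised i ≡ g i) reps
      found with filter⁺ (admissible? P) listed
      ... | inj₁ kept    = kept
      ... | inj₂ dropped = ⊥-elim (dropped (admissible-cong P (lookup-result listed) normalised-admissible))
      undo : ∀ x c → x ≡ (x ℤ.- c) ℤ.+ c
      undo = solve-∀
      shift-back : ∀ {g} i → (∀ i → normalised i ≡ g i) → l i ≡ (g +ᶜ firstValues P l) i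
      shift-back i r≗ = trans (undo (l i) (firstValues P l i)) (cong (ℤ._+ firstValues P l i) (r≗ i))

module Slopes where

  open import Defs
  open Finiteness using (CoprimeBlocks)
  open import Data.Nat as ℕ using (suc; _∸_)
  import Data.Nat.Properties as ℕP
  open import Data.Nat.Divisibility using (_∣_; ∣m+n∣m⇒∣n)
  open import Data.Nat.Coprimality using (Coprime; recompute)
  open import Data.Integer as ℤ using (+_; -[1+_])
  import Data.Integer.Properties as ℤP
  open import Data.Rational using (mkℚ; 0ℚ; 1ℚ; _≤_; *≤*)
  open import Data.List using (List; []; _∷_)
  open import Data.List.Relation.Unary.All using (All; []; _∷_)
  open import Data.Product using (_×_; _,_)
  open import Relation.Binary.PropositionalEquality

  -- For a slope ν = p/q ∈ [0, 1] in lowest terms, h_ν = q and m_ν = q − p,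
  -- so gcd(h_ν, m_ν) = gcd(q, p) = 1.
  coprime-slope : ∀ ν → 0ℚ ≤ ν → ν ≤ 1ℚ → Coprime (hν ν) (mν ν)
  coprime-slope (mkℚ (+ p) q-1 p⊥q) _ (*≤* ν≤1) {d} (d∣h , d∣m) =
    recompute p⊥q (∣m+n∣m⇒∣n (subst (d ∣_) (ℕP.+-comm p _) d∣h) d∣m , subst (d ∣_) h≡q d∣h)
    where
    p≤q : p ℕ.≤ suc q-1
    p≤q = ℤP.drop‿+≤+ (subst₂ ℤ._≤_ (ℤP.*-identityʳ (+ p)) (ℤP.*-identityˡ (+ suc q-1)) ν≤1)
    h≡q : p ℕ.+ (suc q-1 ∸ p) ≡ suc q-1
    h≡q = ℕP.m+[n∸m]≡n p≤q
  coprime-slope (mkℚ -[1+ p ] q-1 p⊥q) (*≤* ()) _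

  coprime-blocks : ∀ P → All (λ ν → (0ℚ ≤ ν) × (ν ≤ 1ℚ)) P → CoprimeBlocks P
  coprime-blocks []      []                  = []
  coprime-blocks (ν ∷ P) ((0≤ν , ν≤1) ∷ νs) = coprime-slope ν 0≤ν ν≤1 ∷ coprime-blocks P νs

module Conjugation where

  open import Defs
  open Cycle
  open Polygon
  open import Level using (Level)
  open import Algebra.Bundles using (CommutativeRing)
  import Algebra.Definitions.RawMonoid as RawMonoidDefs
  import Algebra.Properties.CommutativeSemigroup as CommutativeSemigroupProperties
  open import Data.Nat as ℕ using (ℕ; zero; suc; _≡ᵇ_; _<ᵇ_)
  import Data.Nat.Properties as ℕP
  open import Data.Nat.DivMod using (_%_)
  open import Data.Integer as ℤ using (ℤ; +_; -[1+_]; _⊖_)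
  import Data.Integer.Properties as ℤP
  open import Data.Integer.Tactic.RingSolver using (solve-∀)
  open import Data.Fin as Fin using (Fin; toℕ; _↑ˡ_; _↑ʳ_)
  open import Data.Fin.Permutation as Perm using (Permutation; _⟨$⟩ʳ_)
  open import Data.Fin.Properties using (toℕ-injective; toℕ-fromℕ<; suc-injective; splitAt-↑ˡ; splitAt-↑ʳ; ↑ˡ-injective; ↑ʳ-injective)
  open import Data.Bool using (true; false; if_then_else_)
  open import Data.Product using (_×_; _,_; Σ; proj₁; proj₂)
  open import Data.List using (_∷_)
  open import Data.Sum using (_⊎_; inj₁; inj₂)
  open import Data.Empty using (⊥-elim)
  open import Relation.Nullary using (¬_)
  open import Relation.Nullary.Reflects using (Reflects; ofʸ; ofⁿ; fromEquivalence; det)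
  open import Relation.Binary.PropositionalEquality as ≡ using (_≡_)

  ≡ᵇ-reflects : ∀ a b → Reflects (a ≡ b) (a ≡ᵇ b)
  ≡ᵇ-reflects a b = fromEquivalence (ℕP.≡ᵇ⇒≡ a b) (ℕP.≡⇒≡ᵇ a b)

  module _ {c ℓ : Level} (K : CommutativeRing c ℓ) (ε ε⁻¹ : CommutativeRing.Carrier K) where

    open CommutativeRing K
    open Over K ε ε⁻¹
    open RawMonoidDefs +-rawMonoid using (sum)
    open CommutativeSemigroupProperties *-commutativeSemigroup using (interchange)
    open import Relation.Binary.Reasoning.Setoid setoid

    sum-zero : ∀ {n} (f : Fin n → Carrier) → (∀ k → f k ≈ 0#) → sum f ≈ 0#
    sum-zero {zero}  f z = refl
    sum-zero {suc n} f z = trans (+-cong (z Fin.zero) (sum-zero (λ k → f (Fin.suc k)) (λ k → z (Fin.suc k)))) (+-identityʳ 0#)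

    sum-single : ∀ {n} (f : Fin n → Carrier) (c : Fin n) → (∀ k → ¬ k ≡ c → f k ≈ 0#) → sum f ≈ f c
    sum-single {suc n} f Fin.zero z =
      trans (+-congˡ (sum-zero (λ k → f (Fin.suc k)) (λ k → z (Fin.suc k) (λ ())))) (+-identityʳ _)
    sum-single {suc n} f (Fin.suc c) z = trans (+-congʳ (z Fin.zero (λ ())))
      (trans (+-identityˡ _) (sum-single (λ k → f (Fin.suc k)) c (λ k k≢c → z (Fin.suc k) (λ e → k≢c (suc-injective e)))))

    diag-entry : ∀ {h} (d : Fin h → Carrier) a b → (a ≡ b × diag d a b ≡ d a) ⊎ (¬ a ≡ b × diag d a b ≡ 0#)
    diag-entry d a b with toℕ a ≡ᵇ toℕ b | ≡ᵇ-reflects (toℕ a) (toℕ b)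
    ... | true  | ofʸ a≡b = inj₁ (toℕ-injective a≡b , ≡.refl)
    ... | false | ofⁿ a≢b = inj₂ ((λ e → a≢b (≡.cong toℕ e)) , ≡.refl)

    -- A monomial matrix: column j has the single entry d j, in row π j.
    -- Permutation matrices and x_𝒫 are of this form.
    monomial : ∀ {h} → (Fin h → Fin h) → (Fin h → Carrier) → Mat h
    monomial π d i j = if toℕ (π j) ≡ᵇ toℕ i then d j else 0#

    monomial-entry : ∀ {h} (π : Fin h → Fin h) d i j →
      (π j ≡ i × monomial π d i j ≡ d j) ⊎ (¬ π j ≡ i × monomial π d i j ≡ 0#)
    monomial-entry π d i j with toℕ (π j) ≡ᵇ toℕ i | ≡ᵇ-reflects (toℕ (π j)) (toℕ i)
    ... | true  | ofʸ hit  = inj₁ (toℕ-injective hit , ≡.refl)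
    ... | false | ofⁿ miss = inj₂ ((λ e → miss (≡.cong toℕ e)) , ≡.refl)

    monomial-miss : ∀ {h} (π : Fin h → Fin h) d i j → ¬ π j ≡ i → monomial π d i j ≡ 0#
    monomial-miss π d i j miss with monomial-entry π d i j
    ... | inj₁ (hit , _) = ⊥-elim (miss hit)
    ... | inj₂ (_ , e)   = e

    diag-diagonal : ∀ {h} (d : Fin h → Carrier) a → diag d a a ≡ d a
    diag-diagonal d a with diag-entry d a a
    ... | inj₁ (_ , e)   = e
    ... | inj₂ (a≢a , _) = ⊥-elim (a≢a ≡.refl)

    diag-· : ∀ {h} (d : Fin h → Carrier) (X : Mat h) i k → (diag d · X) i k ≈ d i * X i k
    diag-· d X i k = trans (sum-single _ i off) (*-congʳ (reflexive (diag-diagonal d i)))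
      where
      off : ∀ t → ¬ t ≡ i → diag d i t * X t k ≈ 0#
      off t t≢i with diag-entry d i t
      ... | inj₁ (i≡t , _) = ⊥-elim (t≢i (≡.sym i≡t))
      ... | inj₂ (_ , e)   = trans (*-congʳ (reflexive e)) (zeroˡ _)

    ·-diag : ∀ {h} (d : Fin h → Carrier) (X : Mat h) i k → (X · diag d) i k ≈ X i k * d k
    ·-diag d X i k = trans (sum-single _ k off) (*-congˡ (reflexive (diag-diagonal d k)))
      where
      off : ∀ t → ¬ t ≡ k → X i t * diag d t k ≈ 0#
      off t t≢k with diag-entry d t k
      ... | inj₁ (t≡k , _) = ⊥-elim (t≢k t≡k)
      ... | inj₂ (_ , e)   = trans (*-congˡ (reflexive e)) (zeroʳ _)

    ·-monomial : ∀ {h} (X : Mat h) (π : Fin h → Fin h) d i j → (X · monomial π d) i j ≈ X i (π j) * d j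
    ·-monomial X π d i j = trans (sum-single _ (π j) off) (*-congˡ (reflexive on))
      where
      off : ∀ t → ¬ t ≡ π j → X i t * monomial π d t j ≈ 0#
      off t t≢πj with monomial-entry π d t j
      ... | inj₁ (πj≡t , _) = ⊥-elim (t≢πj (≡.sym πj≡t))
      ... | inj₂ (_ , e)    = trans (*-congˡ (reflexive e)) (zeroʳ _)
      on : monomial π d (π j) j ≡ d j
      on with monomial-entry π d (π j) j
      ... | inj₁ (_ , e)     = e
      ... | inj₂ (πj≢πj , _) = ⊥-elim (πj≢πj ≡.refl)

    conjugate-diag : ∀ {h} (d d′ : Fin h → Carrier) (X : Mat h) i j → ((diag d · X) · diag d′) i j ≈ (d i * X i j) * d′ j
    conjugate-diag d d′ X i j = trans (·-diag d′ (diag d · X) i j) (*-congʳ (diag-· d X i j))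

    scale-monomial : ∀ {h} (d d′ : Fin h → Carrier) (π : Fin h → Fin h) e i j →
      (d i * monomial π e i j) * d′ j ≈ monomial π (λ j → (d (π j) * e j) * d′ j) i j
    scale-monomial d d′ π e i j with monomial-entry π e i j | monomial-entry π (λ j → (d (π j) * e j) * d′ j) i j
    ... | inj₁ (≡.refl , e₁) | inj₁ (_ , e₂) = trans (*-congʳ (*-congˡ (reflexive e₁))) (sym (reflexive e₂))
    ... | inj₂ (_ , e₁)      | inj₂ (_ , e₂) =
      trans (*-congʳ (trans (*-congˡ (reflexive e₁)) (zeroʳ _))) (trans (zeroˡ _) (sym (reflexive e₂)))
    ... | inj₁ (hit , _)     | inj₂ (miss , _) = ⊥-elim (miss hit)
    ... | inj₂ (miss , _)    | inj₁ (hit , _)  = ⊥-elim (miss hit)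

    monomial-cong : ∀ {h} {π π′ : Fin h → Fin h} {d d′} → (∀ j → π j ≡ π′ j) → (∀ j → d j ≈ d′ j) →
      monomial π d ≈ᴹ monomial π′ d′
    monomial-cong {π = π} {π′} {d} {d′} π≗π′ d≈d′ i j rewrite π≗π′ j with toℕ (π′ j) ≡ᵇ toℕ i
    ... | true  = d≈d′ j
    ... | false = refl

    monomial-value : ∀ {h} (π π′ : Fin h → Fin h) d d′ → monomial π d ≈ᴹ monomial π′ d′ →
      ∀ j → ¬ d j ≈ 0# → d j ≈ d′ j
    monomial-value π π′ d d′ eq j d≉0
      with monomial-entry π d (π j) j | monomial-entry π′ d′ (π j) j
    ... | inj₂ (πj≢πj , _) | _             = ⊥-elim (πj≢πj ≡.refl)
    ... | inj₁ (_ , e₁)    | inj₁ (_ , e₂) = trans (sym (reflexive e₁)) (trans (eq (π j) j) (reflexive e₂))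
    ... | inj₁ (_ , e₁)    | inj₂ (_ , e₂) = ⊥-elim (d≉0 (trans (sym (reflexive e₁)) (trans (eq (π j) j) (reflexive e₂))))

    μ-entry : ℕ → ∀ {h} → Fin h → Carrier
    μ-entry s k = if toℕ k <ᵇ s then ε else 1#

    μ-entry-cases : ∀ s {h} (k : Fin h) → μ-entry s k ≡ ε ⊎ μ-entry s k ≡ 1#
    μ-entry-cases s k with toℕ k <ᵇ s
    ... | true  = inj₁ ≡.refl
    ... | false = inj₂ ≡.refl

    WεμW-monomial : ∀ {h} s (w₁ w₂ : Permutation h h) →
      ((permMat w₁ · εμ h s) · permMat w₂) ≈ᴹ monomial (λ j → w₁ ⟨$⟩ʳ (w₂ ⟨$⟩ʳ j)) (λ j → μ-entry s (w₂ ⟨$⟩ʳ j))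
    WεμW-monomial {h} s w₁ w₂ i j = begin
      ((permMat w₁ · εμ h s) · permMat w₂) i j        ≈⟨ ·-monomial (permMat w₁ · εμ h s) (w₂ ⟨$⟩ʳ_) (λ _ → 1#) i j ⟩
      (permMat w₁ · εμ h s) i (w₂ ⟨$⟩ʳ j) * 1#         ≈⟨ *-identityʳ _ ⟩
      (permMat w₁ · εμ h s) i (w₂ ⟨$⟩ʳ j)              ≈⟨ ·-diag (μ-entry s) (permMat w₁) i (w₂ ⟨$⟩ʳ j) ⟩
      permMat w₁ i (w₂ ⟨$⟩ʳ j) * μ-entry s (w₂ ⟨$⟩ʳ j) ≈⟨ select (toℕ (w₁ ⟨$⟩ʳ (w₂ ⟨$⟩ʳ j)) ≡ᵇ toℕ i) ⟩
      monomial (λ j → w₁ ⟨$⟩ʳ (w₂ ⟨$⟩ʳ j)) (λ j → μ-entry s (w₂ ⟨$⟩ʳ j)) i j ∎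
      where
      select : ∀ b → (if b then 1# else 0#) * μ-entry s (w₂ ⟨$⟩ʳ j) ≈ (if b then μ-entry s (w₂ ⟨$⟩ʳ j) else 0#)
      select true  = *-identityˡ _
      select false = zeroˡ _

    monomial-entry-≡ : ∀ {h h′} (π : Fin h → Fin h) (π′ : Fin h′ → Fin h′) d d′ i j i′ j′ →
      (π j ≡ i → π′ j′ ≡ i′) → (π′ j′ ≡ i′ → π j ≡ i) → d j ≡ d′ j′ →
      monomial π d i j ≡ monomial π′ d′ i′ j′
    monomial-entry-≡ π π′ d d′ i j i′ j′ to from d≡d′ with monomial-entry π d i j | monomial-entry π′ d′ i′ j′
    ... | inj₁ (_ , e)    | inj₁ (_ , e′)    = ≡.trans e (≡.trans d≡d′ (≡.sym e′))
    ... | inj₂ (_ , e)    | inj₂ (_ , e′)    = ≡.trans e (≡.sym e′)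
    ... | inj₁ (hit , _)  | inj₂ (miss , _)  = ⊥-elim (miss (to hit))
    ... | inj₂ (miss , _) | inj₁ (hit , _)   = ⊥-elim (miss (from hit))

    xmat-monomial : ∀ n h i j → xmat n h i j ≡ monomial (blockRow n h) (λ j → εⁿ (blockExp n h j)) i j
    xmat-monomial n (suc k) i j = ≡.cong (λ b → if b then εⁿ (blockExp n (suc k) j) else 0#)
      (det (≡ᵇ-reflects (toℕ i) row)
           (fromEquivalence (λ t → ≡.trans (≡.sym (ℕP.≡ᵇ⇒≡ _ _ t)) (toℕ-fromℕ< _))
                            (λ i≡row → ℕP.≡⇒≡ᵇ _ _ (≡.trans (toℕ-fromℕ< _) (≡.sym i≡row)))))
      where
      row : ℕ
      row = k ℕ.∸ (suc k ℕ.∸ toℕ j ℕ.+ n ℕ.∸ 1) % suc k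

    xP-first-first : ∀ ν P a b → xP (ν ∷ P) (a ↑ˡ hP P) (b ↑ˡ hP P) ≡ x (nν ν) (mν ν) a b
    xP-first-first ν P a b rewrite splitAt-↑ˡ (hν ν) a (hP P) | splitAt-↑ˡ (hν ν) b (hP P) = ≡.refl

    xP-rest-rest : ∀ ν P a b → xP (ν ∷ P) (hν ν ↑ʳ a) (hν ν ↑ʳ b) ≡ xP P a b
    xP-rest-rest ν P a b rewrite splitAt-↑ʳ (hν ν) (hP P) a | splitAt-↑ʳ (hν ν) (hP P) b = ≡.refl

    xP-first-rest : ∀ ν P a b → xP (ν ∷ P) (a ↑ˡ hP P) (hν ν ↑ʳ b) ≡ 0#
    xP-first-rest ν P a b rewrite splitAt-↑ˡ (hν ν) a (hP P) | splitAt-↑ʳ (hν ν) (hP P) b = ≡.refl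

    xP-rest-first : ∀ ν P a b → xP (ν ∷ P) (hν ν ↑ʳ a) (b ↑ˡ hP P) ≡ 0#
    xP-rest-first ν P a b rewrite splitAt-↑ʳ (hν ν) (hP P) a | splitAt-↑ˡ (hν ν) b (hP P) = ≡.refl

    xP-monomial : ∀ P (i j : Fin (hP P)) → xP P i j ≡ monomial (rowOf P) (λ j → εⁿ (rowExp P j)) i j
    xP-monomial (ν ∷ P) i j with blockView (hν ν) (hP P) i | blockView (hν ν) (hP P) j
    ... | inFirst a | inFirst b = ≡.trans (xP-first-first ν P a b) (≡.trans (xmat-monomial (nν ν) (hν ν) a b)
            (monomial-entry-≡ (blockRow (nν ν) (hν ν)) (rowOf (ν ∷ P)) (λ j → εⁿ (blockExp (nν ν) (hν ν) j)) (λ j → εⁿ (rowExp (ν ∷ P) j)) a b (a ↑ˡ hP P) (b ↑ˡ hP P)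
              (λ hit → ≡.trans (rowOf-first ν P b) (≡.cong (_↑ˡ hP P) hit))
              (λ hit → ↑ˡ-injective (hP P) _ _ (≡.trans (≡.sym (rowOf-first ν P b)) hit))
              (≡.cong εⁿ (≡.sym (rowExp-first ν P b)))))
    ... | inRest a  | inRest b  = ≡.trans (xP-rest-rest ν P a b) (≡.trans (xP-monomial P a b)
            (monomial-entry-≡ (rowOf P) (rowOf (ν ∷ P)) (λ j → εⁿ (rowExp P j)) (λ j → εⁿ (rowExp (ν ∷ P) j)) a b (hν ν ↑ʳ a) (hν ν ↑ʳ b)
              (λ hit → ≡.trans (rowOf-rest ν P b) (≡.cong (hν ν ↑ʳ_) hit))
              (λ hit → ↑ʳ-injective (hν ν) _ _ (≡.trans (≡.sym (rowOf-rest ν P b)) hit))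
              (≡.cong εⁿ (≡.sym (rowExp-rest ν P b)))))
    ... | inFirst a | inRest b  = ≡.trans (xP-first-rest ν P a b) (≡.sym (monomial-miss (rowOf (ν ∷ P)) (λ j → εⁿ (rowExp (ν ∷ P) j)) _ _
            (λ hit → ↑ˡ≢↑ʳ a (rowOf P b) (≡.sym (≡.trans (≡.sym (rowOf-rest ν P b)) hit)))))
    ... | inRest a  | inFirst b = ≡.trans (xP-rest-first ν P a b) (≡.sym (monomial-miss (rowOf (ν ∷ P)) (λ j → εⁿ (rowExp (ν ∷ P) j)) _ _
            (λ hit → ↑ˡ≢↑ʳ (blockRow (nν ν) (hν ν) b) a (≡.trans (≡.sym (rowOf-first ν P b)) hit))))

    εⁿ-+ : ∀ a b → εⁿ (a ℕ.+ b) ≈ εⁿ a * εⁿ b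
    εⁿ-+ zero    b = sym (*-identityˡ _)
    εⁿ-+ (suc a) b = trans (*-congˡ (εⁿ-+ a b)) (sym (*-assoc _ _ _))

    ε⁻ⁿ-+ : ∀ a b → ε⁻ⁿ (a ℕ.+ b) ≈ ε⁻ⁿ a * ε⁻ⁿ b
    ε⁻ⁿ-+ zero    b = sym (*-identityˡ _)
    ε⁻ⁿ-+ (suc a) b = trans (*-congˡ (ε⁻ⁿ-+ a b)) (sym (*-assoc _ _ _))

    module _ (ε-inverse : ε * ε⁻¹ ≈ 1#) where

      εᶻ-⊖ : ∀ a b → εᶻ (a ⊖ b) ≈ εⁿ a * ε⁻ⁿ b
      εᶻ-⊖ a       zero    = sym (*-identityʳ _)
      εᶻ-⊖ zero    (suc b) = sym (*-identityˡ _)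
      εᶻ-⊖ (suc a) (suc b) = begin
        εᶻ (suc a ⊖ suc b)         ≡⟨ ≡.cong εᶻ (ℤP.[1+m]⊖[1+n]≡m⊖n a b) ⟩
        εᶻ (a ⊖ b)                 ≈⟨ εᶻ-⊖ a b ⟩
        εⁿ a * ε⁻ⁿ b               ≈⟨ *-identityˡ _ ⟨
        1# * (εⁿ a * ε⁻ⁿ b)        ≈⟨ *-congʳ ε-inverse ⟨
        (ε * ε⁻¹) * (εⁿ a * ε⁻ⁿ b) ≈⟨ interchange ε ε⁻¹ (εⁿ a) (ε⁻ⁿ b) ⟩
        εⁿ (suc a) * ε⁻ⁿ (suc b)   ∎

      εᶻ-+ : ∀ x y → εᶻ (x ℤ.+ y) ≈ εᶻ x * εᶻ y
      εᶻ-+ (+ a)    (+ b)    = εⁿ-+ a b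
      εᶻ-+ (+ a)    -[1+ b ] = εᶻ-⊖ a (suc b)
      εᶻ-+ -[1+ a ] (+ b)    = trans (εᶻ-⊖ b (suc a)) (*-comm _ _)
      εᶻ-+ -[1+ a ] -[1+ b ] = begin
        ε⁻ⁿ (suc (suc (a ℕ.+ b)))  ≡⟨ ≡.cong (λ z → ε⁻ⁿ (suc z)) (ℕP.+-suc a b) ⟨
        ε⁻ⁿ (suc a ℕ.+ suc b)      ≈⟨ ε⁻ⁿ-+ (suc a) (suc b) ⟩
        ε⁻ⁿ (suc a) * ε⁻ⁿ (suc b)  ∎

      εᶻ-inverse : ∀ z → εᶻ z * εᶻ (ℤ.- z) ≈ 1#
      εᶻ-inverse z = trans (sym (εᶻ-+ z (ℤ.- z))) (reflexive (≡.cong εᶻ (ℤP.+-inverseʳ z)))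

      conjugate-xP : ∀ P l → ((ε^- l · xP P) · ε^ l) ≈ᴹ monomial (rowOf P) (λ j → εᶻ (exponent P l j))
      conjugate-xP P l i j = begin
        ((ε^- l · xP P) · ε^ l) i j
          ≈⟨ conjugate-diag (λ k → εᶻ (ℤ.- l k)) (λ k → εᶻ (l k)) (xP P) i j ⟩
        (εᶻ (ℤ.- l i) * xP P i j) * εᶻ (l j)
          ≡⟨ ≡.cong (λ z → (εᶻ (ℤ.- l i) * z) * εᶻ (l j)) (xP-monomial P i j) ⟩
        (εᶻ (ℤ.- l i) * monomial (rowOf P) (λ j → εⁿ (rowExp P j)) i j) * εᶻ (l j)
          ≈⟨ scale-monomial (λ k → εᶻ (ℤ.- l k)) (λ k → εᶻ (l k)) (rowOf P) (λ j → εⁿ (rowExp P j)) i j ⟩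
        monomial (rowOf P) (λ j → (εᶻ (ℤ.- l (rowOf P j)) * εⁿ (rowExp P j)) * εᶻ (l j)) i j
          ≈⟨ monomial-cong {π = rowOf P} (λ _ → ≡.refl) collect i j ⟩
        monomial (rowOf P) (λ j → εᶻ (exponent P l j)) i j ∎
        where
        reorder : ∀ a x z → (a ℤ.+ x) ℤ.- z ≡ (ℤ.- z ℤ.+ a) ℤ.+ x
        reorder = solve-∀
        collect : ∀ j → (εᶻ (ℤ.- l (rowOf P j)) * εⁿ (rowExp P j)) * εᶻ (l j) ≈ εᶻ (exponent P l j)
        collect j = begin
          (εᶻ (ℤ.- l (rowOf P j)) * εⁿ (rowExp P j)) * εᶻ (l j) ≈⟨ *-congʳ (εᶻ-+ (ℤ.- l (rowOf P j)) (+ rowExp P j)) ⟨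
          εᶻ (ℤ.- l (rowOf P j) ℤ.+ + rowExp P j) * εᶻ (l j)   ≈⟨ εᶻ-+ (ℤ.- l (rowOf P j) ℤ.+ + rowExp P j) (l j) ⟨
          εᶻ ((ℤ.- l (rowOf P j) ℤ.+ + rowExp P j) ℤ.+ l j)    ≡⟨ ≡.cong εᶻ (reorder (+ rowExp P j) (l j) (l (rowOf P j))) ⟨
          εᶻ (exponent P l j)                                  ∎

      εᶻ≉0 : ¬ 1# ≈ 0# → ∀ z → ¬ εᶻ z ≈ 0#
      εᶻ≉0 1≉0 z e = 1≉0 (trans (sym (εᶻ-inverse z)) (trans (*-congʳ e) (zeroˡ _)))

      εᶻ≈1⇒0 : (∀ k → ¬ εⁿ (suc k) ≈ 1#) → ∀ z → εᶻ z ≈ 1# → z ≡ + 0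
      εᶻ≈1⇒0 εⁿ≉1 (+ zero)  e = ≡.refl
      εᶻ≈1⇒0 εⁿ≉1 (+ suc k) e = ⊥-elim (εⁿ≉1 k e)
      εᶻ≈1⇒0 εⁿ≉1 -[1+ k ]  e = ⊥-elim (εⁿ≉1 k (begin
        εⁿ (suc k)                ≈⟨ *-identityʳ _ ⟨
        εⁿ (suc k) * 1#           ≈⟨ *-congˡ e ⟨
        εⁿ (suc k) * ε⁻ⁿ (suc k)  ≈⟨ εᶻ-inverse (+ suc k) ⟩
        1#                        ∎))

      εᶻ≈ε⇒1 : (∀ k → ¬ εⁿ (suc k) ≈ 1#) → ∀ z → εᶻ z ≈ ε → z ≡ + 1
      εᶻ≈ε⇒1 εⁿ≉1 z e = ≡.trans (shift z) (≡.cong (ℤ._+ + 1) (εᶻ≈1⇒0 εⁿ≉1 (z ℤ.+ -[1+ 0 ]) divided))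
        where
        shift : ∀ z → z ≡ (z ℤ.- + 1) ℤ.+ + 1
        shift = solve-∀
        divided : εᶻ (z ℤ.+ -[1+ 0 ]) ≈ 1#
        divided = begin
          εᶻ (z ℤ.+ -[1+ 0 ]) ≈⟨ εᶻ-+ z -[1+ 0 ] ⟩
          εᶻ z * (ε⁻¹ * 1#)   ≈⟨ *-cong e (*-identityʳ ε⁻¹) ⟩
          ε * ε⁻¹             ≈⟨ ε-inverse ⟩
          1#                  ∎

      -- If λ ∈ X_*(T)^𝒫, comparing the monomial forms of both sides shows
      -- that every entry ε^{e_j} is ε or 1, i.e. λ is admissible.
      XP⇒admissible : ¬ 1# ≈ 0# → (∀ k → ¬ εⁿ (suc k) ≈ 1#) → ∀ P l → XP P l → Admissible P l
      XP⇒admissible 1≉0 εⁿ≉1 P l (w₁ , w₂ , conj≈) j = from-entry (μ-entry-cases (sP P) (w₂ ⟨$⟩ʳ j))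
        where
        same : monomial (rowOf P) (λ j → εᶻ (exponent P l j))
            ≈ᴹ monomial (λ j → w₁ ⟨$⟩ʳ (w₂ ⟨$⟩ʳ j)) (λ j → μ-entry (sP P) (w₂ ⟨$⟩ʳ j))
        same i j = trans (sym (conjugate-xP P l i j)) (trans (conj≈ i j) (WεμW-monomial (sP P) w₁ w₂ i j))
        entry : εᶻ (exponent P l j) ≈ μ-entry (sP P) (w₂ ⟨$⟩ʳ j)
        entry = monomial-value (rowOf P) (λ j → w₁ ⟨$⟩ʳ (w₂ ⟨$⟩ʳ j))
          (λ j → εᶻ (exponent P l j)) (λ j → μ-entry (sP P) (w₂ ⟨$⟩ʳ j)) same j (εᶻ≉0 1≉0 (exponent P l j))
        from-entry : μ-entry (sP P) (w₂ ⟨$⟩ʳ j) ≡ ε ⊎ μ-entry (sP P) (w₂ ⟨$⟩ʳ j) ≡ 1# →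
          exponent P l j ≡ + 0 ⊎ exponent P l j ≡ + 1
        from-entry (inj₁ is-ε) = inj₂ (εᶻ≈ε⇒1 εⁿ≉1 _ (trans entry (reflexive is-ε)))
        from-entry (inj₂ is-1) = inj₁ (εᶻ≈1⇒0 εⁿ≉1 _ (trans entry (reflexive is-1)))

      -- Conversely, sort the s positions with entry ε to the front (w₂) and
      -- then follow the rows of x_𝒫 (w₁ = w₂⁻¹ ∘ rowOf).
      admissible⇒XP : ∀ P l → Admissible P l → XP P l
      admissible⇒XP P l adm = w₁ , w₂ , λ i j →
        trans (conjugate-xP P l i j) (trans (monomial-cong rows values i j) (sym (WεμW-monomial (sP P) w₁ w₂ i j)))
        where
        sorted : Σ (Permutation (hP P) (hP P)) λ w → ∀ j → (toℕ (w ⟨$⟩ʳ j) <ᵇ count (isOne P l)) ≡ isOne P l j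
        sorted = sortingPermutation (hP P) (isOne P l)
        w₁ w₂ : Permutation (hP P) (hP P)
        w₂ = proj₁ sorted
        w₁ = Perm.flip w₂ Perm.∘ₚ rowPerm P
        rows : ∀ j → rowOf P j ≡ w₁ ⟨$⟩ʳ (w₂ ⟨$⟩ʳ j)
        rows j = ≡.cong (rowOf P) (≡.sym (Perm.inverseˡ w₂))
        front : ∀ j → (toℕ (w₂ ⟨$⟩ʳ j) <ᵇ sP P) ≡ isOne P l j
        front j = ≡.trans (≡.cong (toℕ (w₂ ⟨$⟩ʳ j) <ᵇ_) (≡.sym (count-isOne P l adm))) (proj₂ sorted j)
        values : ∀ j → εᶻ (exponent P l j) ≈ μ-entry (sP P) (w₂ ⟨$⟩ʳ j)
        values j rewrite front j with exponent P l j | adm j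
        ... | _ | inj₁ ≡.refl = refl
        ... | _ | inj₂ ≡.refl = *-identityʳ ε

open import Defs
open import Algebra.Bundles using (CommutativeRing)
open import Data.Nat using (ℕ; suc)
open import Data.Rational using (ℚ; 0ℚ; 1ℚ; _≤_)
open import Data.List using (List)
open import Data.List.Relation.Unary.All as All using (All)
open import Data.List.Relation.Unary.Any using (Any)
open import Data.List.Relation.Unary.Linked using (Linked)
open import Data.Product using (_×_; _,_; Σ; ∃-syntax)
open import Relation.Nullary using (¬_)
open import Relation.Binary.PropositionalEquality using (_≡_)

open Polygon using (Admissible; admissible-shift)
open Finiteness using (admissible-representatives)
open Slopes using (coprime-blocks)
open Conjugation using (XP⇒admissible; admissible⇒XP)

lemma5p5 : ∀ {c ℓ} (K : CommutativeRing c ℓ) (ε ε⁻¹ : CommutativeRing.Carrier K)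
    → CommutativeRing._≈_ K (CommutativeRing._*_ K ε ε⁻¹) (CommutativeRing.1# K)
    → ¬ CommutativeRing._≈_ K (CommutativeRing.1# K) (CommutativeRing.0# K)
    → (∀ (k : ℕ) → ¬ CommutativeRing._≈_ K (Over.εⁿ K ε ε⁻¹ (suc k)) (CommutativeRing.1# K))
    → (P : List ℚ)
    → All (λ ν → (0ℚ ≤ ν) × (ν ≤ 1ℚ)) P
    → Linked _≤_ P
    → ((l c′ : Cochar (hP P)) → Over.XP K ε ε⁻¹ P l → ConstOnBlocks P c′
         → Over.XP K ε ε⁻¹ P (l +ᶜ c′))
      × (Σ (List (Cochar (hP P))) λ reps →
           All (Over.XP K ε ε⁻¹ P) reps
           × ((l : Cochar (hP P)) → Over.XP K ε ε⁻¹ P l →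
                Any (λ r → ∃[ c′ ] (ConstOnBlocks P c′ × (∀ i → l i ≡ (r +ᶜ c′) i))) reps))
lemma5p5 K ε ε⁻¹ ε-inverse 1≉0 εⁿ≉1 P slopes _
  with admissible-representatives P (coprime-blocks P slopes)
... | reps , reps-admissible , reps-cover =
  (λ l c′ l∈X c′-const → to-X (l +ᶜ c′) (admissible-shift P l c′ c′-const (from-X l l∈X)))
  , reps , All.map (λ {l} → to-X l) reps-admissible , λ l l∈X → reps-cover l (from-X l l∈X)
  where
  from-X : ∀ l → Over.XP K ε ε⁻¹ P l → Admissible P l
  from-X = XP⇒admissible K ε ε⁻¹ ε-inverse 1≉0 εⁿ≉1 P
  to-X : ∀ l → Admissible P l → Over.XP K ε ε⁻¹ P l
  to-X = admissible⇒XP K ε ε⁻¹ ε-inverse P
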